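{- Let $K,d\ge1$, $L=dK$, and let $f:\mathbb{Z}_3^K\to U_3$ and $g:\mathbb{Z}_3^L\to U_3$ be folded. If $(x,y,z,w)$ is drawn from the $\mathsf{4NAT}$ test distribution, then $$\mathbb{E}[f(x)g(y)g(z)] = \sum_{\alpha\in\mathbb{Z}_3^L}\hat f(\pi_3(\alpha))\,\hat g(\alpha)^2\left(-\tfrac12\right)^{\#\alpha}.$$
   Context: $\omega=e^{2\pi i/3}$, $U_3=\{\omega^0,\omega^1,\omega^2\}$. A function $h:\mathbb{Z}_3^n\to U_3$ is folded if $h(x+c\mathbf 1)=\omega^c h(x)$ for all $x$ and $c\in\mathbb{Z}_3$. Fourier coefficients: $\hat h(\alpha)=\mathbb{E}_x[h(x)\overline{\omega^{\alpha\cdot x}}]$, $x$ uniform on $\mathbb{Z}_3^n$. For $\alpha\in\mathbb{Z}_3^L$, $\#\alpha$ is the number of nonzero coordinates; strings in $\mathbb{Z}_3^L$ are split into $K$ consecutive blocks of size $d$, with $\alpha[i]\in\mathbb{Z}_3^d$ the $i$th block, and $\pi_3(\alpha)\in\mathbb{Z}_3^K$ has $i$th coordinate $\sum_j(\alpha[i])_j \bmod 3$. $\mathsf{TwoPair}:\mathbb{Z}_3^4\to\{0,1\}$ outputs $1$ iff its input consists of two distinct elements of $\mathbb{Z}_3$, each appearing exactly twice. The $\mathsf{4NAT}$ test distribution: $x\in\mathbb{Z}_3^K$ is uniform; then independently for each $i\in[K]$, $j\in[d]$, the triple $((y[i])_j,(z[i])_j,(w[i])_j)$ is uniform among triples $(b,c,e)\in\mathbb{Z}_3^3$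 with $\mathsf{TwoPair}(x_i,b,c,e)=1$. -}

module Defs where

open import Data.Nat as ℕ using (ℕ; zero; suc)
open import Data.Fin using (Fin; zero; suc)
open import Data.Bool using (Bool; true; false; if_then_else_; _∧_; _∨_)
open import Data.Integer using (+_)
open import Data.Rational as ℚ using (ℚ; 0ℚ; 1ℚ; _/_)
open import Data.List as List using (List; []; _∷_; concatMap; foldr)
open import Data.Vec as Vec using (Vec; []; _∷_; take; drop; replicate; zipWith)
open import Data.Product using (Σ)
open import Data.Nat.ListAction using () renaming (sum to sumℕ)
open import Relation.Binary.PropositionalEquality using (_≡_)

Z3 : Set
Z3 = Fin 3

_+₃_ : Z3 → Z3 → Z3
zero +₃ b = b
suc zero +₃ zero = suc zero
suc zero +₃ suc zero = suc (suc zero)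
suc zero +₃ suc (suc zero) = zero
suc (suc zero) +₃ zero = suc (suc zero)
suc (suc zero) +₃ suc zero = zero
suc (suc zero) +₃ suc (suc zero) = suc zero

_*₃_ : Z3 → Z3 → Z3
zero *₃ b = zero
suc zero *₃ b = b
suc (suc zero) *₃ b = b +₃ b

allZ3 : List Z3
allZ3 = zero ∷ suc zero ∷ suc (suc zero) ∷ []

_==₃_ : Z3 → Z3 → Bool
zero ==₃ zero = true
suc zero ==₃ suc zero = true
suc (suc zero) ==₃ suc (suc zero) = true
_ ==₃ _ = false

isNonzero : Z3 → Bool
isNonzero zero = false
isNonzero (suc _) = true

_+ᵥ_ : ∀ {n} → Vec Z3 n → Vec Z3 n → Vec Z3 n
_+ᵥ_ = zipWith _+₃_

const1 : ∀ n → Z3 → Vec Z3 n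
const1 n c = replicate n c

dot : ∀ {n} → Vec Z3 n → Vec Z3 n → Z3
dot [] [] = zero
dot (a ∷ as) (b ∷ bs) = (a *₃ b) +₃ dot as bs

allVecs : ∀ n → List (Vec Z3 n)
allVecs zero = [] ∷ []
allVecs (suc n) = concatMap (λ a → List.map (a ∷_) (allVecs n)) allZ3

hash : ∀ {n} → Vec Z3 n → ℕ
hash [] = 0
hash (a ∷ as) = (if isNonzero a then 1 else 0) ℕ.+ hash as

sum₃ : ∀ {n} → Vec Z3 n → Z3
sum₃ [] = zero
sum₃ (a ∷ as) = a +₃ sum₃ as

blocks : ∀ K d → Vec Z3 (K ℕ.* d) → Vec (Vec Z3 d) K
blocks zero d v = []
blocks (suc K) d v = take d v ∷ blocks K d (drop d v)

π₃ : ∀ K d → Vec Z3 (K ℕ.* d) → Vec Z3 K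
π₃ K d α = Vec.map sum₃ (blocks K d α)

-- ℚ(ω) = { a + b ω : a b ∈ ℚ },  ω² = -1 - ω  (contains U₃, closed under
-- conjugation; all quantities in the statement live here)

record Qω : Set where
  constructor _+_ω
  field
    re : ℚ
    im : ℚ
open Qω public

infixl 6 _⊕_
infixl 7 _⊗_

_⊕_ : Qω → Qω → Qω
(a + b ω) ⊕ (c + d ω) = (a ℚ.+ c) + (b ℚ.+ d) ω

-- (a + bω)(c + dω) = ac + (ad + bc)ω + bd ω² = (ac - bd) + (ad + bc - bd)ω
_⊗_ : Qω → Qω → Qω
(a + b ω) ⊗ (c + d ω) = (a ℚ.* c ℚ.- b ℚ.* d) + (a ℚ.* d ℚ.+ b ℚ.* c ℚ.- b ℚ.* d) ω

-- complex conjugation: ω̄ = ω² = -1 - ω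
conj : Qω → Qω
conj (a + b ω) = (a ℚ.- b) + (ℚ.- b) ω

embed : ℚ → Qω
embed q = q + 0ℚ ω

zeroω : Qω
zeroω = 0ℚ + 0ℚ ω

oneω : Qω
oneω = 1ℚ + 0ℚ ω

ωpow : Z3 → Qω
ωpow zero = oneω
ωpow (suc zero) = 0ℚ + 1ℚ ω
ωpow (suc (suc zero)) = (ℚ.- 1ℚ) + (ℚ.- 1ℚ) ω

_^ω_ : Qω → ℕ → Qω
q ^ω zero = oneω
q ^ω suc n = q ⊗ (q ^ω n)

sumList : List Qω → Qω
sumList = foldr _⊕_ zeroω

Σ∈ : ∀ n → (Vec Z3 n → Qω) → Qω
Σ∈ n F = sumList (List.map F (allVecs n))

𝔼 : ∀ n → (Vec Z3 n → Qω) → Qω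
𝔼 n F = embed (+ 1 / 3) ^ω n ⊗ Σ∈ n F

InU3 : Qω → Set
InU3 v = Σ Z3 (λ e → v ≡ ωpow e)

Folded : ∀ n → (Vec Z3 n → Qω) → Set
Folded n h = (∀ x → InU3 (h x)) ×' (∀ x c → h (x +ᵥ const1 n c) ≡ ωpow c ⊗ h x)
  where
    open import Data.Product renaming (_×_ to _×'_)

hat : ∀ n → (Vec Z3 n → Qω) → Vec Z3 n → Qω
hat n h α = 𝔼 n (λ x → h x ⊗ conj (ωpow (dot α x)))

TwoPair : Z3 → Z3 → Z3 → Z3 → Bool
TwoPair a b c e =
  ((a ==₃ b) ∧ (c ==₃ e) ∧ not' (a ==₃ c)) ∨
  ((a ==₃ c) ∧ (b ==₃ e) ∧ not' (a ==₃ b)) ∨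
  ((a ==₃ e) ∧ (b ==₃ c) ∧ not' (a ==₃ b))
  where
    not' : Bool → Bool
    not' true = false
    not' false = true

ind : Bool → ℚ
ind true = 1ℚ
ind false = 0ℚ

countTP : Z3 → ℕ
countTP a = sumℕ (List.map (λ b → sumℕ (List.map (λ c → sumℕ
              (List.map (λ e → if TwoPair a b c e then 1 else 0) allZ3)) allZ3)) allZ3)

inv : ℕ → ℚ
inv zero = 0ℚ
inv (suc n) = + 1 / suc n

pTriple : Z3 → Z3 → Z3 → Z3 → ℚ
pTriple a b c e = ind (TwoPair a b c e) ℚ.* inv (countTP a)

pBlock : ∀ {d} → Z3 → Vec Z3 d → Vec Z3 d → Vec Z3 d → ℚ
pBlock a [] [] [] = 1ℚ
pBlock a (b ∷ bs) (c ∷ cs) (e ∷ es) = pTriple a b c e ℚ.* pBlock a bs cs es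

pCond : ∀ {K d} → Vec Z3 K → Vec (Vec Z3 d) K → Vec (Vec Z3 d) K → Vec (Vec Z3 d) K → ℚ
pCond [] [] [] [] = 1ℚ
pCond (a ∷ as) (y ∷ ys) (z ∷ zs) (w ∷ ws) = pBlock a y z w ℚ.* pCond as ys zs ws

𝔼4NAT : ∀ K d → (Vec Z3 K → Vec Z3 (K ℕ.* d) → Vec Z3 (K ℕ.* d) → Vec Z3 (K ℕ.* d) → Qω) → Qω
𝔼4NAT K d F =
  𝔼 K (λ x → Σ∈ (K ℕ.* d) (λ y → Σ∈ (K ℕ.* d) (λ z → Σ∈ (K ℕ.* d) (λ w →
    embed (pCond x (blocks K d y) (blocks K d z) (blocks K d w)) ⊗ F x y z w))))

-- Given x_i = a, a coordinate pair (y_j, z_j) of the i-th block is uniform over the six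
-- pairs (b, c) with a + b + c ≠ 0, so its density is
-- (1/9) Σ_t (-1/2)^[t ≠ 0] ω^(-t(a + b + c)).  Multiplying over all coordinates gives the
-- density of (x, y, z) as (1/3)^K (1/9)^L Σ_α (-1/2)^#α ω^(-(π₃(α)·x + α·y + α·z)), and
-- inserting it into the expectation and exchanging the sums leaves f̂(π₃ α) ĝ(α) ĝ(α) for
-- every α.
module Submission where

open import Defs
open import Algebra.Bundles using (CommutativeSemiring)
open import Data.Bool using (if_then_else_)
open import Data.Fin using (zero; suc)
open import Data.Integer using (+_; -[1+_])
open import Data.List as List using (List; []; _∷_)
open import Data.List.Properties using (map-++; map-∘)
open import Data.Maybe using (nothing)
open import Data.Nat as ℕ using (ℕ; zero; suc; _≤_; _*_)
import Data.Nat.Properties as ℕₚ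
open import Data.Rational as ℚ using (0ℚ; 1ℚ; _/_)
import Data.Rational.Properties as ℚₚ
open import Data.Vec as Vec using (Vec; _∷_; []; _++_; take; drop)
open import Level using (0ℓ)
open import Relation.Binary.PropositionalEquality
  using (_≡_; refl; sym; trans; cong; cong₂; module ≡-Reasoning)
open import Algebra.Structures.Biased {A = Qω} _≡_ using (isCommutativeSemiringʳ; isCommutativeMonoidˡ)
open import Relation.Binary.PropositionalEquality.Algebra using (isMagma)
open import Relation.Nullary.Decidable using (dec⇒maybe)
open import Tactic.RingSolver using (solve-∀)
open import Tactic.RingSolver.Core.AlmostCommutativeRing
  using (AlmostCommutativeRing; fromCommutativeRing; fromCommutativeSemiring)

open ≡-Reasoning

private
  variable
    A B C D : Set
    m n : ℕ

-- ℚ(ω) is a commutative semiring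

ℚ-ring : AlmostCommutativeRing 0ℓ 0ℓ
ℚ-ring = fromCommutativeRing ℚₚ.+-*-commutativeRing (λ x → dec⇒maybe (0ℚ ℚ.≟ x))

module _ where
  open ℚ using (_-_) renaming (_+_ to _+ℚ_; _*_ to _*ℚ_)

  ⊕-assoc : ∀ x y z → (x ⊕ y) ⊕ z ≡ x ⊕ (y ⊕ z)
  ⊕-assoc (a + b ω) (c + d ω) (e + f ω) = cong₂ _+_ω (ℚₚ.+-assoc a c e) (ℚₚ.+-assoc b d f)

  ⊕-comm : ∀ x y → x ⊕ y ≡ y ⊕ x
  ⊕-comm (a + b ω) (c + d ω) = cong₂ _+_ω (ℚₚ.+-comm a c) (ℚₚ.+-comm b d)

  ⊕-identityˡ : ∀ x → zeroω ⊕ x ≡ x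
  ⊕-identityˡ (a + b ω) = cong₂ _+_ω (ℚₚ.+-identityˡ a) (ℚₚ.+-identityˡ b)

  ⊗-comm : ∀ x y → x ⊗ y ≡ y ⊗ x
  ⊗-comm (a + b ω) (c + d ω) = cong₂ _+_ω (re-eq a b c d) (im-eq a b c d)
    where
    re-eq : ∀ a b c d → a *ℚ c - b *ℚ d ≡ c *ℚ a - d *ℚ b
    re-eq = solve-∀ ℚ-ring
    im-eq : ∀ a b c d → a *ℚ d +ℚ b *ℚ c - b *ℚ d ≡ c *ℚ b +ℚ d *ℚ a - d *ℚ b
    im-eq = solve-∀ ℚ-ring

  ⊗-assoc : ∀ x y z → (x ⊗ y) ⊗ z ≡ x ⊗ (y ⊗ z)
  ⊗-assoc (a + b ω) (c + d ω) (e + f ω) = cong₂ _+_ω (re-eq a b c d e f) (im-eq a b c d e f)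
    where
    re-eq : ∀ a b c d e f → (a *ℚ c - b *ℚ d) *ℚ e - (a *ℚ d +ℚ b *ℚ c - b *ℚ d) *ℚ f
                          ≡ a *ℚ (c *ℚ e - d *ℚ f) - b *ℚ (c *ℚ f +ℚ d *ℚ e - d *ℚ f)
    re-eq = solve-∀ ℚ-ring
    im-eq : ∀ a b c d e f →
      (a *ℚ c - b *ℚ d) *ℚ f +ℚ (a *ℚ d +ℚ b *ℚ c - b *ℚ d) *ℚ e - (a *ℚ d +ℚ b *ℚ c - b *ℚ d) *ℚ f
        ≡ a *ℚ (c *ℚ f +ℚ d *ℚ e - d *ℚ f) +ℚ b *ℚ (c *ℚ e - d *ℚ f) - b *ℚ (c *ℚ f +ℚ d *ℚ e - d *ℚ f)
    im-eq = solve-∀ ℚ-ring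

  ⊗-identityˡ : ∀ x → oneω ⊗ x ≡ x
  ⊗-identityˡ (a + b ω) = cong₂ _+_ω (re-eq a b) (im-eq a b)
    where
    re-eq : ∀ a b → 1ℚ *ℚ a - 0ℚ *ℚ b ≡ a
    re-eq = solve-∀ ℚ-ring
    im-eq : ∀ a b → 1ℚ *ℚ b +ℚ 0ℚ *ℚ a - 0ℚ *ℚ b ≡ b
    im-eq = solve-∀ ℚ-ring

  ⊗-distribˡ-⊕ : ∀ x y z → x ⊗ (y ⊕ z) ≡ x ⊗ y ⊕ x ⊗ z
  ⊗-distribˡ-⊕ (a + b ω) (c + d ω) (e + f ω) = cong₂ _+_ω (re-eq a b c d e f) (im-eq a b c d e f)
    where
    re-eq : ∀ a b c d e f → a *ℚ (c +ℚ e) - b *ℚ (d +ℚ f) ≡ (a *ℚ c - b *ℚ d) +ℚ (a *ℚ e - b *ℚ f)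
    re-eq = solve-∀ ℚ-ring
    im-eq : ∀ a b c d e f → a *ℚ (d +ℚ f) +ℚ b *ℚ (c +ℚ e) - b *ℚ (d +ℚ f)
                          ≡ (a *ℚ d +ℚ b *ℚ c - b *ℚ d) +ℚ (a *ℚ f +ℚ b *ℚ e - b *ℚ f)
    im-eq = solve-∀ ℚ-ring

  ⊗-zeroʳ : ∀ x → x ⊗ zeroω ≡ zeroω
  ⊗-zeroʳ (a + b ω) = cong₂ _+_ω (re-eq a b) (im-eq a b)
    where
    re-eq : ∀ a b → a *ℚ 0ℚ - b *ℚ 0ℚ ≡ 0ℚ
    re-eq = solve-∀ ℚ-ring
    im-eq : ∀ a b → a *ℚ 0ℚ +ℚ b *ℚ 0ℚ - b *ℚ 0ℚ ≡ 0ℚ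
    im-eq = solve-∀ ℚ-ring

  embed-* : ∀ p q → embed (p *ℚ q) ≡ embed p ⊗ embed q
  embed-* p q = cong₂ _+_ω (re-eq p q) (im-eq p q)
    where
    re-eq : ∀ p q → p *ℚ q ≡ p *ℚ q - 0ℚ *ℚ 0ℚ
    re-eq = solve-∀ ℚ-ring
    im-eq : ∀ p q → 0ℚ ≡ p *ℚ 0ℚ +ℚ 0ℚ *ℚ q - 0ℚ *ℚ 0ℚ
    im-eq = solve-∀ ℚ-ring

Qω-commutativeSemiring : CommutativeSemiring 0ℓ 0ℓ
Qω-commutativeSemiring = record
  { Carrier = Qω
  ; _≈_ = _≡_
  ; _+_ = _⊕_
  ; _*_ = _⊗_
  ; 0# = zeroω
  ; 1# = oneω
  ; isCommutativeSemiring = isCommutativeSemiringʳ record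
    { +-isCommutativeMonoid = isCommutativeMonoidˡ record
      { isSemigroup = record { isMagma = isMagma _⊕_ ; assoc = ⊕-assoc }
      ; identityˡ = ⊕-identityˡ
      ; comm = ⊕-comm
      }
    ; *-isCommutativeMonoid = isCommutativeMonoidˡ record
      { isSemigroup = record { isMagma = isMagma _⊗_ ; assoc = ⊗-assoc }
      ; identityˡ = ⊗-identityˡ
      ; comm = ⊗-comm
      }
    ; distribˡ = ⊗-distribˡ-⊕
    ; zeroʳ = ⊗-zeroʳ
    }
  }

Qω-ring : AlmostCommutativeRing 0ℓ 0ℓ
Qω-ring = fromCommutativeSemiring Qω-commutativeSemiring (λ _ → nothing)

open CommutativeSemiring Qω-commutativeSemiring
  using (+-commutativeSemigroup; *-commutativeSemigroup)
  renaming (+-identityʳ to ⊕-identityʳ; *-identityʳ to ⊗-identityʳ)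
open import Algebra.Properties.CommutativeSemigroup +-commutativeSemigroup
  using () renaming (interchange to ⊕-interchange)
open import Algebra.Properties.CommutativeSemigroup *-commutativeSemigroup
  using () renaming (interchange to ⊗-interchange)

^ω-homo-⊗ : ∀ x m n → x ^ω (m ℕ.+ n) ≡ x ^ω m ⊗ x ^ω n
^ω-homo-⊗ x zero n = sym (⊗-identityˡ _)
^ω-homo-⊗ x (suc m) n = trans (cong (x ⊗_) (^ω-homo-⊗ x m n)) (sym (⊗-assoc x _ _))

^ω-distrib-⊗ : ∀ x y n → (x ⊗ y) ^ω n ≡ x ^ω n ⊗ y ^ω n
^ω-distrib-⊗ x y zero = sym (⊗-identityˡ oneω)
^ω-distrib-⊗ x y (suc n) = trans (cong ((x ⊗ y) ⊗_) (^ω-distrib-⊗ x y n)) (⊗-interchange x y _ _)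

+₃-assoc : ∀ a b c → (a +₃ b) +₃ c ≡ a +₃ (b +₃ c)
+₃-assoc zero b c = refl
+₃-assoc (suc zero) zero c = refl
+₃-assoc (suc (suc zero)) zero c = refl
+₃-assoc (suc zero) (suc zero) zero = refl
+₃-assoc (suc zero) (suc zero) (suc zero) = refl
+₃-assoc (suc zero) (suc zero) (suc (suc zero)) = refl
+₃-assoc (suc zero) (suc (suc zero)) zero = refl
+₃-assoc (suc zero) (suc (suc zero)) (suc zero) = refl
+₃-assoc (suc zero) (suc (suc zero)) (suc (suc zero)) = refl
+₃-assoc (suc (suc zero)) (suc zero) zero = refl
+₃-assoc (suc (suc zero)) (suc zero) (suc zero) = refl
+₃-assoc (suc (suc zero)) (suc zero) (suc (suc zero)) = refl
+₃-assoc (suc (suc zero)) (suc (suc zero)) zero = refl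
+₃-assoc (suc (suc zero)) (suc (suc zero)) (suc zero) = refl
+₃-assoc (suc (suc zero)) (suc (suc zero)) (suc (suc zero)) = refl

*₃-distribʳ-+₃ : ∀ a b c → (a +₃ b) *₃ c ≡ (a *₃ c) +₃ (b *₃ c)
*₃-distribʳ-+₃ zero b c = refl
*₃-distribʳ-+₃ (suc zero) zero zero = refl
*₃-distribʳ-+₃ (suc zero) zero (suc zero) = refl
*₃-distribʳ-+₃ (suc zero) zero (suc (suc zero)) = refl
*₃-distribʳ-+₃ (suc zero) (suc zero) zero = refl
*₃-distribʳ-+₃ (suc zero) (suc zero) (suc zero) = refl
*₃-distribʳ-+₃ (suc zero) (suc zero) (suc (suc zero)) = refl
*₃-distribʳ-+₃ (suc zero) (suc (suc zero)) zero = refl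
*₃-distribʳ-+₃ (suc zero) (suc (suc zero)) (suc zero) = refl
*₃-distribʳ-+₃ (suc zero) (suc (suc zero)) (suc (suc zero)) = refl
*₃-distribʳ-+₃ (suc (suc zero)) zero zero = refl
*₃-distribʳ-+₃ (suc (suc zero)) zero (suc zero) = refl
*₃-distribʳ-+₃ (suc (suc zero)) zero (suc (suc zero)) = refl
*₃-distribʳ-+₃ (suc (suc zero)) (suc zero) zero = refl
*₃-distribʳ-+₃ (suc (suc zero)) (suc zero) (suc zero) = refl
*₃-distribʳ-+₃ (suc (suc zero)) (suc zero) (suc (suc zero)) = refl
*₃-distribʳ-+₃ (suc (suc zero)) (suc (suc zero)) zero = refl
*₃-distribʳ-+₃ (suc (suc zero)) (suc (suc zero)) (suc zero) = refl
*₃-distribʳ-+₃ (suc (suc zero)) (suc (suc zero)) (suc (suc zero)) = refl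

χ : Z3 → Qω
χ s = conj (ωpow s)

χ-+₃ : ∀ a b → χ (a +₃ b) ≡ χ a ⊗ χ b
χ-+₃ zero zero = refl
χ-+₃ zero (suc zero) = refl
χ-+₃ zero (suc (suc zero)) = refl
χ-+₃ (suc zero) zero = refl
χ-+₃ (suc zero) (suc zero) = refl
χ-+₃ (suc zero) (suc (suc zero)) = refl
χ-+₃ (suc (suc zero)) zero = refl
χ-+₃ (suc (suc zero)) (suc zero) = refl
χ-+₃ (suc (suc zero)) (suc (suc zero)) = refl

-- Finite sums

sumOver : List A → (A → Qω) → Qω
sumOver xs F = sumList (List.map F xs)

sumOver-cong : ∀ (xs : List A) {F G : A → Qω} → (∀ a → F a ≡ G a) → sumOver xs F ≡ sumOver xs G
sumOver-cong [] eq = refl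
sumOver-cong (x ∷ xs) eq = cong₂ _⊕_ (eq x) (sumOver-cong xs eq)

⊗-distribˡ-sumOver : ∀ c (xs : List A) (F : A → Qω) → c ⊗ sumOver xs F ≡ sumOver xs (λ a → c ⊗ F a)
⊗-distribˡ-sumOver c [] F = ⊗-zeroʳ c
⊗-distribˡ-sumOver c (x ∷ xs) F =
  trans (⊗-distribˡ-⊕ c (F x) _) (cong (c ⊗ F x ⊕_) (⊗-distribˡ-sumOver c xs F))

⊗-distribʳ-sumOver : ∀ c (xs : List A) (F : A → Qω) → sumOver xs F ⊗ c ≡ sumOver xs (λ a → F a ⊗ c)
⊗-distribʳ-sumOver c xs F = begin
  sumOver xs F ⊗ c               ≡⟨ ⊗-comm _ c ⟩
  c ⊗ sumOver xs F               ≡⟨ ⊗-distribˡ-sumOver c xs F ⟩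
  sumOver xs (λ a → c ⊗ F a)     ≡⟨ sumOver-cong xs (λ a → ⊗-comm c (F a)) ⟩
  sumOver xs (λ a → F a ⊗ c)     ∎

sumOver-distrib-⊕ : ∀ (xs : List A) (F G : A → Qω) →
  sumOver xs (λ a → F a ⊕ G a) ≡ sumOver xs F ⊕ sumOver xs G
sumOver-distrib-⊕ [] F G = sym (⊕-identityˡ zeroω)
sumOver-distrib-⊕ (x ∷ xs) F G =
  trans (cong (F x ⊕ G x ⊕_) (sumOver-distrib-⊕ xs F G)) (⊕-interchange (F x) (G x) _ _)

sumOver-zero : ∀ (xs : List A) → sumOver xs (λ _ → zeroω) ≡ zeroω
sumOver-zero [] = refl
sumOver-zero (x ∷ xs) = trans (cong (zeroω ⊕_) (sumOver-zero xs)) (⊕-identityˡ zeroω)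

sumOver-comm : ∀ (xs : List A) (ys : List B) (F : A → B → Qω) →
  sumOver xs (λ a → sumOver ys (F a)) ≡ sumOver ys (λ b → sumOver xs (λ a → F a b))
sumOver-comm [] ys F = sym (sumOver-zero ys)
sumOver-comm (x ∷ xs) ys F =
  trans (cong (sumOver ys (F x) ⊕_) (sumOver-comm xs ys F))
        (sym (sumOver-distrib-⊕ ys (F x) (λ b → sumOver xs (λ a → F a b))))

sumOver-⊗-sumOver : ∀ (xs : List A) (ys : List B) (F : A → Qω) (G : B → Qω) →
  sumOver xs F ⊗ sumOver ys G ≡ sumOver xs (λ a → sumOver ys (λ b → F a ⊗ G b))
sumOver-⊗-sumOver xs ys F G =
  trans (⊗-distribʳ-sumOver (sumOver ys G) xs F)
        (sumOver-cong xs (λ a → ⊗-distribˡ-sumOver (F a) ys G))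

sumOver-rescale-⊗ : ∀ (xs : List A) (ys : List B) (P F : A → Qω) (Q G : B → Qω) c e →
  sumOver xs P ≡ c ⊗ sumOver xs F → sumOver ys Q ≡ e ⊗ sumOver ys G →
  sumOver xs (λ a → sumOver ys (λ b → P a ⊗ Q b))
    ≡ (c ⊗ e) ⊗ sumOver xs (λ a → sumOver ys (λ b → F a ⊗ G b))
sumOver-rescale-⊗ xs ys P F Q G c e ΣP ΣQ = begin
  sumOver xs (λ a → sumOver ys (λ b → P a ⊗ Q b))
    ≡⟨ sym (sumOver-⊗-sumOver xs ys P Q) ⟩
  sumOver xs P ⊗ sumOver ys Q
    ≡⟨ cong₂ _⊗_ ΣP ΣQ ⟩
  (c ⊗ sumOver xs F) ⊗ (e ⊗ sumOver ys G)
    ≡⟨ ⊗-interchange c _ e _ ⟩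
  (c ⊗ e) ⊗ (sumOver xs F ⊗ sumOver ys G)
    ≡⟨ cong ((c ⊗ e) ⊗_) (sumOver-⊗-sumOver xs ys F G) ⟩
  (c ⊗ e) ⊗ sumOver xs (λ a → sumOver ys (λ b → F a ⊗ G b)) ∎

sumList-++ : ∀ (xs ys : List Qω) → sumList (xs List.++ ys) ≡ sumList xs ⊕ sumList ys
sumList-++ [] ys = sym (⊕-identityˡ (sumList ys))
sumList-++ (x ∷ xs) ys = trans (cong (x ⊕_) (sumList-++ xs ys)) (sym (⊕-assoc x _ _))

sumOver-concatMap : ∀ (xs : List A) (h : A → List B) (F : B → Qω) →
  sumOver (List.concatMap h xs) F ≡ sumOver xs (λ a → sumOver (h a) F)
sumOver-concatMap [] h F = refl
sumOver-concatMap (x ∷ xs) h F = begin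
  sumList (List.map F (h x List.++ List.concatMap h xs))
    ≡⟨ cong sumList (map-++ F (h x) _) ⟩
  sumList (List.map F (h x) List.++ List.map F (List.concatMap h xs))
    ≡⟨ sumList-++ (List.map F (h x)) _ ⟩
  sumOver (h x) F ⊕ sumOver (List.concatMap h xs) F
    ≡⟨ cong (sumOver (h x) F ⊕_) (sumOver-concatMap xs h F) ⟩
  sumOver (h x) F ⊕ sumOver xs (λ a → sumOver (h a) F) ∎

sumOver-map : ∀ (xs : List A) (h : A → B) (F : B → Qω) →
  sumOver (List.map h xs) F ≡ sumOver xs (λ a → F (h a))
sumOver-map xs h F = cong sumList (sym (map-∘ xs))

Σ∈-cons : ∀ n (F : Vec Z3 (suc n) → Qω) → Σ∈ (suc n) F ≡ sumOver allZ3 (λ a → Σ∈ n (λ v → F (a ∷ v)))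
Σ∈-cons n F = trans (sumOver-concatMap allZ3 (λ a → List.map (a ∷_) (allVecs n)) F)
                    (sumOver-cong allZ3 (λ a → sumOver-map (allVecs n) (a ∷_) F))

Σ∈-++ : ∀ m n (F : Vec Z3 (m ℕ.+ n) → Qω) → Σ∈ (m ℕ.+ n) F ≡ Σ∈ m (λ u → Σ∈ n (λ v → F (u ++ v)))
Σ∈-++ zero n F = sym (⊕-identityʳ _)
Σ∈-++ (suc m) n F = begin
  Σ∈ (suc m ℕ.+ n) F
    ≡⟨ Σ∈-cons (m ℕ.+ n) F ⟩
  sumOver allZ3 (λ a → Σ∈ (m ℕ.+ n) (λ w → F (a ∷ w)))
    ≡⟨ sumOver-cong allZ3 (λ a → Σ∈-++ m n (λ w → F (a ∷ w))) ⟩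
  sumOver allZ3 (λ a → Σ∈ m (λ u → Σ∈ n (λ v → F (a ∷ u ++ v))))
    ≡⟨ sym (Σ∈-cons m (λ u → Σ∈ n (λ v → F (u ++ v)))) ⟩
  Σ∈ (suc m) (λ u → Σ∈ n (λ v → F (u ++ v))) ∎

sumOver³ : List A → List B → List C → (A → B → C → Qω) → Qω
sumOver³ xs ys zs T = sumOver xs λ x → sumOver ys λ y → sumOver zs λ z → T x y z

sumOver³-cong : ∀ (xs : List A) (ys : List B) (zs : List C) {S T : A → B → C → Qω} →
  (∀ x y z → S x y z ≡ T x y z) → sumOver³ xs ys zs S ≡ sumOver³ xs ys zs T
sumOver³-cong xs ys zs eq =
  sumOver-cong xs λ x → sumOver-cong ys λ y → sumOver-cong zs λ z → eq x y z

⊗-distribˡ-sumOver³ : ∀ c (xs : List A) (ys : List B) (zs : List C) (T : A → B → C → Qω) →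
  c ⊗ sumOver³ xs ys zs T ≡ sumOver³ xs ys zs (λ x y z → c ⊗ T x y z)
⊗-distribˡ-sumOver³ c xs ys zs T = begin
  c ⊗ sumOver³ xs ys zs T
    ≡⟨ ⊗-distribˡ-sumOver c xs _ ⟩
  sumOver xs (λ x → c ⊗ sumOver ys λ y → sumOver zs (T x y))
    ≡⟨ sumOver-cong xs (λ x → ⊗-distribˡ-sumOver c ys _) ⟩
  sumOver xs (λ x → sumOver ys λ y → c ⊗ sumOver zs (T x y))
    ≡⟨ sumOver-cong xs (λ x → sumOver-cong ys λ y → ⊗-distribˡ-sumOver c zs _) ⟩
  sumOver³ xs ys zs (λ x y z → c ⊗ T x y z) ∎

sumOver-⊗³ : ∀ (xs : List A) (ys : List B) (zs : List C) (F : A → Qω) (G : B → Qω) (H : C → Qω) →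
  sumOver xs F ⊗ (sumOver ys G ⊗ sumOver zs H) ≡ sumOver³ xs ys zs (λ x y z → F x ⊗ (G y ⊗ H z))
sumOver-⊗³ xs ys zs F G H = begin
  sumOver xs F ⊗ (sumOver ys G ⊗ sumOver zs H)
    ≡⟨ cong (sumOver xs F ⊗_) (sumOver-⊗-sumOver ys zs G H) ⟩
  sumOver xs F ⊗ sumOver ys (λ y → sumOver zs λ z → G y ⊗ H z)
    ≡⟨ sumOver-⊗-sumOver xs ys F _ ⟩
  sumOver xs (λ x → sumOver ys λ y → F x ⊗ sumOver zs λ z → G y ⊗ H z)
    ≡⟨ sumOver-cong xs (λ x → sumOver-cong ys λ y → ⊗-distribˡ-sumOver (F x) zs _) ⟩
  sumOver³ xs ys zs (λ x y z → F x ⊗ (G y ⊗ H z)) ∎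

sumOver-comm³ : ∀ (ws : List D) (xs : List A) (ys : List B) (zs : List C)
  (T : D → A → B → C → Qω) →
  sumOver ws (λ w → sumOver³ xs ys zs (T w))
    ≡ sumOver³ xs ys zs (λ x y z → sumOver ws λ w → T w x y z)
sumOver-comm³ ws xs ys zs T = begin
  sumOver ws (λ w → sumOver³ xs ys zs (T w))
    ≡⟨ sumOver-comm ws xs _ ⟩
  sumOver xs (λ x → sumOver ws λ w → sumOver ys λ y → sumOver zs (T w x y))
    ≡⟨ sumOver-cong xs (λ x → sumOver-comm ws ys _) ⟩
  sumOver xs (λ x → sumOver ys λ y → sumOver ws λ w → sumOver zs (T w x y))
    ≡⟨ sumOver-cong xs (λ x → sumOver-cong ys λ y → sumOver-comm ws zs _) ⟩
  sumOver³ xs ys zs (λ x y z → sumOver ws λ w → T w x y z) ∎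

take-++ : ∀ (u : Vec A m) (v : Vec A n) → take m (u ++ v) ≡ u
take-++ [] v = refl
take-++ (a ∷ u) v = cong (a ∷_) (take-++ u v)

drop-++ : ∀ (u : Vec A m) (v : Vec A n) → drop m (u ++ v) ≡ v
drop-++ [] v = refl
drop-++ (a ∷ u) v = drop-++ u v

blocks-++ : ∀ K d (u : Vec Z3 d) (v : Vec Z3 (K * d)) → blocks (suc K) d (u ++ v) ≡ u ∷ blocks K d v
blocks-++ K d u v = cong₂ (λ p q → p ∷ blocks K d q) (take-++ u v) (drop-++ u v)

hash-++ : ∀ (u : Vec Z3 m) (v : Vec Z3 n) → hash (u ++ v) ≡ hash u ℕ.+ hash v
hash-++ [] v = refl
hash-++ (a ∷ u) v = trans (cong (#a ℕ.+_) (hash-++ u v)) (sym (ℕₚ.+-assoc #a (hash u) (hash v)))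
  where #a = if isNonzero a then 1 else 0

dot-++ : ∀ (u : Vec Z3 m) (v : Vec Z3 n) y → dot (u ++ v) y ≡ dot u (take m y) +₃ dot v (drop m y)
dot-++ [] v y = refl
dot-++ (a ∷ u) v (b ∷ y) =
  trans (cong ((a *₃ b) +₃_) (dot-++ u v y)) (sym (+₃-assoc (a *₃ b) _ _))

sum₃-++ : ∀ (u : Vec Z3 m) (v : Vec Z3 n) → sum₃ (u ++ v) ≡ sum₃ u +₃ sum₃ v
sum₃-++ [] v = refl
sum₃-++ (t ∷ u) v = trans (cong (t +₃_) (sum₃-++ u v)) (sym (+₃-assoc t _ _))

-- The Fourier expansion of the 4NAT density

⅓ ⅑ -½ : Qω
⅓ = embed (+ 1 / 3)
⅑ = ⅓ ⊗ ⅓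
-½ = embed (-[1+ 0 ] / 2)

weight : ℕ → Z3 → Z3 → Z3 → Qω
weight k s t r = -½ ^ω k ⊗ (χ s ⊗ (χ t ⊗ χ r))

blockWeight : Z3 → (y z u : Vec Z3 n) → Qω
blockWeight a y z u = weight (hash u) (sum₃ u *₃ a) (dot u y) (dot u z)

fourierWeight : ∀ K d → Vec Z3 K → (y z α : Vec Z3 (K * d)) → Qω
fourierWeight K d x y z α = weight (hash α) (dot (π₃ K d α) x) (dot α y) (dot α z)

weight-cong : ∀ {k k′ s s′ t t′ r r′} → k ≡ k′ → s ≡ s′ → t ≡ t′ → r ≡ r′ →
  weight k s t r ≡ weight k′ s′ t′ r′
weight-cong refl refl refl refl = refl

weight-+ : ∀ k₁ k₂ s₁ s₂ t₁ t₂ r₁ r₂ →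
  weight (k₁ ℕ.+ k₂) (s₁ +₃ s₂) (t₁ +₃ t₂) (r₁ +₃ r₂) ≡ weight k₁ s₁ t₁ r₁ ⊗ weight k₂ s₂ t₂ r₂
weight-+ k₁ k₂ s₁ s₂ t₁ t₂ r₁ r₂ = begin
  -½ ^ω (k₁ ℕ.+ k₂) ⊗ (χ (s₁ +₃ s₂) ⊗ (χ (t₁ +₃ t₂) ⊗ χ (r₁ +₃ r₂)))
    ≡⟨ cong₂ _⊗_ (^ω-homo-⊗ -½ k₁ k₂) (cong₂ _⊗_ (χ-+₃ s₁ s₂) (cong₂ _⊗_ (χ-+₃ t₁ t₂) (χ-+₃ r₁ r₂))) ⟩
  (p ⊗ p′) ⊗ ((χ s₁ ⊗ χ s₂) ⊗ ((χ t₁ ⊗ χ t₂) ⊗ (χ r₁ ⊗ χ r₂)))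
    ≡⟨ cong (λ e → (p ⊗ p′) ⊗ ((χ s₁ ⊗ χ s₂) ⊗ e)) (⊗-interchange (χ t₁) (χ t₂) _ _) ⟩
  (p ⊗ p′) ⊗ ((χ s₁ ⊗ χ s₂) ⊗ ((χ t₁ ⊗ χ r₁) ⊗ (χ t₂ ⊗ χ r₂)))
    ≡⟨ cong ((p ⊗ p′) ⊗_) (⊗-interchange (χ s₁) (χ s₂) _ _) ⟩
  (p ⊗ p′) ⊗ ((χ s₁ ⊗ (χ t₁ ⊗ χ r₁)) ⊗ (χ s₂ ⊗ (χ t₂ ⊗ χ r₂)))
    ≡⟨ ⊗-interchange p p′ _ _ ⟩
  weight k₁ s₁ t₁ r₁ ⊗ weight k₂ s₂ t₂ r₂ ∎
  where
  p = -½ ^ω k₁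
  p′ = -½ ^ω k₂

blockWeight-++ : ∀ a (u : Vec Z3 m) (v : Vec Z3 n) y z →
  blockWeight a y z (u ++ v)
    ≡ blockWeight a (take m y) (take m z) u ⊗ blockWeight a (drop m y) (drop m z) v
blockWeight-++ {m} a u v y z = trans
  (weight-cong (hash-++ u v) (trans (cong (_*₃ a) (sum₃-++ u v)) (*₃-distribʳ-+₃ (sum₃ u) (sum₃ v) a))
               (dot-++ u v y) (dot-++ u v z))
  (weight-+ (hash u) (hash v) (sum₃ u *₃ a) (sum₃ v *₃ a)
            (dot u (take m y)) (dot v (drop m y)) (dot u (take m z)) (dot v (drop m z)))

fourierWeight-++ : ∀ K d a x (u : Vec Z3 d) (v : Vec Z3 (K * d)) y z →
  fourierWeight (suc K) d (a ∷ x) y z (u ++ v)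
    ≡ blockWeight a (take d y) (take d z) u ⊗ fourierWeight K d x (drop d y) (drop d z) v
fourierWeight-++ K d a x u v y z = trans
  (weight-cong (hash-++ u v) (cong (λ β → dot (Vec.map sum₃ β) (a ∷ x)) (blocks-++ K d u v))
               (dot-++ u v y) (dot-++ u v z))
  (weight-+ (hash u) (hash v) (sum₃ u *₃ a) (dot (π₃ K d v) x)
            (dot u (take d y)) (dot v (drop d y)) (dot u (take d z)) (dot v (drop d z)))

coordinateMarginal : ∀ a b c → sumOver allZ3 (λ e → embed (pTriple a b c e))
                               ≡ ⅑ ⊗ sumOver allZ3 (λ t → blockWeight a (b ∷ []) (c ∷ []) (t ∷ []))
coordinateMarginal zero zero zero = refl
coordinateMarginal zero zero (suc zero) = refl
coordinateMarginal zero zero (suc (suc zero)) = refl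
coordinateMarginal zero (suc zero) zero = refl
coordinateMarginal zero (suc zero) (suc zero) = refl
coordinateMarginal zero (suc zero) (suc (suc zero)) = refl
coordinateMarginal zero (suc (suc zero)) zero = refl
coordinateMarginal zero (suc (suc zero)) (suc zero) = refl
coordinateMarginal zero (suc (suc zero)) (suc (suc zero)) = refl
coordinateMarginal (suc zero) zero zero = refl
coordinateMarginal (suc zero) zero (suc zero) = refl
coordinateMarginal (suc zero) zero (suc (suc zero)) = refl
coordinateMarginal (suc zero) (suc zero) zero = refl
coordinateMarginal (suc zero) (suc zero) (suc zero) = refl
coordinateMarginal (suc zero) (suc zero) (suc (suc zero)) = refl
coordinateMarginal (suc zero) (suc (suc zero)) zero = refl
coordinateMarginal (suc zero) (suc (suc zero)) (suc zero) = refl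
coordinateMarginal (suc zero) (suc (suc zero)) (suc (suc zero)) = refl
coordinateMarginal (suc (suc zero)) zero zero = refl
coordinateMarginal (suc (suc zero)) zero (suc zero) = refl
coordinateMarginal (suc (suc zero)) zero (suc (suc zero)) = refl
coordinateMarginal (suc (suc zero)) (suc zero) zero = refl
coordinateMarginal (suc (suc zero)) (suc zero) (suc zero) = refl
coordinateMarginal (suc (suc zero)) (suc zero) (suc (suc zero)) = refl
coordinateMarginal (suc (suc zero)) (suc (suc zero)) zero = refl
coordinateMarginal (suc (suc zero)) (suc (suc zero)) (suc zero) = refl
coordinateMarginal (suc (suc zero)) (suc (suc zero)) (suc (suc zero)) = refl

blockMarginal : ∀ d a (y z : Vec Z3 d) →
  Σ∈ d (λ u → embed (pBlock a y z u)) ≡ ⅑ ^ω d ⊗ Σ∈ d (blockWeight a y z)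
blockMarginal zero a [] [] = refl
blockMarginal (suc d) a (b ∷ y) (c ∷ z) = begin
  Σ∈ (suc d) (λ u → embed (pBlock a (b ∷ y) (c ∷ z) u))
    ≡⟨ Σ∈-cons d _ ⟩
  sumOver allZ3 (λ e → Σ∈ d (λ v → embed (pTriple a b c e ℚ.* pBlock a y z v)))
    ≡⟨ sumOver-cong allZ3 (λ e → sumOver-cong (allVecs d) (λ v → embed-* (pTriple a b c e) (pBlock a y z v))) ⟩
  sumOver allZ3 (λ e → Σ∈ d (λ v → embed (pTriple a b c e) ⊗ embed (pBlock a y z v)))
    ≡⟨ sumOver-rescale-⊗ allZ3 (allVecs d) (λ e → embed (pTriple a b c e)) (λ t → blockWeight a (b ∷ []) (c ∷ []) (t ∷ []))
         (λ v → embed (pBlock a y z v)) (blockWeight a y z) ⅑ (⅑ ^ω d)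
         (coordinateMarginal a b c) (blockMarginal d a y z) ⟩
  ⅑ ^ω suc d ⊗ sumOver allZ3 (λ t → Σ∈ d (λ v →
                 blockWeight a (b ∷ []) (c ∷ []) (t ∷ []) ⊗ blockWeight a y z v))
    ≡⟨ cong (⅑ ^ω suc d ⊗_) (sumOver-cong allZ3 λ t → sumOver-cong (allVecs d) λ v →
         sym (blockWeight-++ a (t ∷ []) v (b ∷ y) (c ∷ z))) ⟩
  ⅑ ^ω suc d ⊗ sumOver allZ3 (λ t → Σ∈ d (λ v → blockWeight a (b ∷ y) (c ∷ z) (t ∷ v)))
    ≡⟨ cong (⅑ ^ω suc d ⊗_) (sym (Σ∈-cons d _)) ⟩
  ⅑ ^ω suc d ⊗ Σ∈ (suc d) (blockWeight a (b ∷ y) (c ∷ z)) ∎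

marginal : ∀ K d (x : Vec Z3 K) (y z : Vec Z3 (K * d)) →
  Σ∈ (K * d) (λ w → embed (pCond x (blocks K d y) (blocks K d z) (blocks K d w)))
    ≡ ⅑ ^ω (K * d) ⊗ Σ∈ (K * d) (fourierWeight K d x y z)
marginal zero d [] [] [] = refl
marginal (suc K) d (a ∷ x) y z = begin
  Σ∈ (d ℕ.+ K * d) (λ w → embed (pCond (a ∷ x) (blocks (suc K) d y) (blocks (suc K) d z) (blocks (suc K) d w)))
    ≡⟨ Σ∈-++ d (K * d) _ ⟩
  Σ∈ d (λ u → Σ∈ (K * d) λ v →
    embed (pCond (a ∷ x) (blocks (suc K) d y) (blocks (suc K) d z) (blocks (suc K) d (u ++ v))))
    ≡⟨ sumOver-cong (allVecs d) (λ u → sumOver-cong (allVecs (K * d)) λ v → trans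
         (cong (λ β → embed (pCond (a ∷ x) (blocks (suc K) d y) (blocks (suc K) d z) β)) (blocks-++ K d u v))
         (embed-* (pBlock a y₁ z₁ u) _)) ⟩
  Σ∈ d (λ u → Σ∈ (K * d) λ v →
    embed (pBlock a y₁ z₁ u) ⊗ embed (pCond x (blocks K d y₂) (blocks K d z₂) (blocks K d v)))
    ≡⟨ sumOver-rescale-⊗ (allVecs d) (allVecs (K * d))
         (λ u → embed (pBlock a y₁ z₁ u)) (blockWeight a y₁ z₁)
         (λ v → embed (pCond x (blocks K d y₂) (blocks K d z₂) (blocks K d v))) (fourierWeight K d x y₂ z₂)
         (⅑ ^ω d) (⅑ ^ω (K * d)) (blockMarginal d a y₁ z₁) (marginal K d x y₂ z₂) ⟩
  (⅑ ^ω d ⊗ ⅑ ^ω (K * d)) ⊗ Σ∈ d (λ u → Σ∈ (K * d) λ v →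
    blockWeight a y₁ z₁ u ⊗ fourierWeight K d x y₂ z₂ v)
    ≡⟨ cong₂ _⊗_ (sym (^ω-homo-⊗ ⅑ d (K * d)))
                 (sumOver-cong (allVecs d) λ u → sumOver-cong (allVecs (K * d)) λ v →
                   sym (fourierWeight-++ K d a x u v y z)) ⟩
  ⅑ ^ω (d ℕ.+ K * d) ⊗ Σ∈ d (λ u → Σ∈ (K * d) λ v → fourierWeight (suc K) d (a ∷ x) y z (u ++ v))
    ≡⟨ cong (⅑ ^ω (d ℕ.+ K * d) ⊗_) (sym (Σ∈-++ d (K * d) _)) ⟩
  ⅑ ^ω (d ℕ.+ K * d) ⊗ Σ∈ (d ℕ.+ K * d) (fourierWeight (suc K) d (a ∷ x) y z) ∎
  where
  y₁ = take d y
  z₁ = take d z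
  y₂ = drop d y
  z₂ = drop d z

𝔼4NAT-expansion : ∀ K d (F : Vec Z3 K → Vec Z3 (K * d) → Vec Z3 (K * d) → Qω) →
  𝔼4NAT K d (λ x y z _ → F x y z)
    ≡ (⅓ ^ω K ⊗ ⅑ ^ω (K * d)) ⊗ sumOver³ (allVecs K) (allVecs (K * d)) (allVecs (K * d))
        (λ x y z → Σ∈ (K * d) λ α → fourierWeight K d x y z α ⊗ F x y z)
𝔼4NAT-expansion K d F = begin
  ⅓ ^ω K ⊗ sumOver³ Xs Ys Ys (λ x y z → Σ∈ L λ w → density x y z w ⊗ F x y z)
    ≡⟨ cong (⅓ ^ω K ⊗_) (sumOver³-cong Xs Ys Ys expand) ⟩
  ⅓ ^ω K ⊗ sumOver³ Xs Ys Ys (λ x y z → ⅑ ^ω L ⊗ Σ∈ L λ α → fourierWeight K d x y z α ⊗ F x y z)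
    ≡⟨ cong (⅓ ^ω K ⊗_) (sym (⊗-distribˡ-sumOver³ (⅑ ^ω L) Xs Ys Ys _)) ⟩
  ⅓ ^ω K ⊗ (⅑ ^ω L ⊗ sumOver³ Xs Ys Ys (λ x y z → Σ∈ L λ α → fourierWeight K d x y z α ⊗ F x y z))
    ≡⟨ sym (⊗-assoc (⅓ ^ω K) (⅑ ^ω L) _) ⟩
  (⅓ ^ω K ⊗ ⅑ ^ω L) ⊗ sumOver³ Xs Ys Ys (λ x y z → Σ∈ L λ α → fourierWeight K d x y z α ⊗ F x y z) ∎
  where
  L = K * d
  Xs = allVecs K
  Ys = allVecs L
  density : Vec Z3 K → (y z w : Vec Z3 L) → Qω
  density x y z w = embed (pCond x (blocks K d y) (blocks K d z) (blocks K d w))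
  expand : ∀ x y z → Σ∈ L (λ w → density x y z w ⊗ F x y z)
                     ≡ ⅑ ^ω L ⊗ Σ∈ L (λ α → fourierWeight K d x y z α ⊗ F x y z)
  expand x y z = begin
    Σ∈ L (λ w → density x y z w ⊗ F x y z)
      ≡⟨ sym (⊗-distribʳ-sumOver (F x y z) Ys (density x y z)) ⟩
    Σ∈ L (density x y z) ⊗ F x y z
      ≡⟨ cong (_⊗ F x y z) (marginal K d x y z) ⟩
    (⅑ ^ω L ⊗ Σ∈ L (fourierWeight K d x y z)) ⊗ F x y z
      ≡⟨ ⊗-assoc (⅑ ^ω L) _ (F x y z) ⟩
    ⅑ ^ω L ⊗ (Σ∈ L (fourierWeight K d x y z) ⊗ F x y z)
      ≡⟨ cong (⅑ ^ω L ⊗_) (⊗-distribʳ-sumOver (F x y z) Ys (fourierWeight K d x y z)) ⟩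
    ⅑ ^ω L ⊗ Σ∈ L (λ α → fourierWeight K d x y z α ⊗ F x y z) ∎

fourier-expansion : ∀ K d (f : Vec Z3 K → Qω) (g h : Vec Z3 (K * d) → Qω) →
  Σ∈ (K * d) (λ α → hat K f (π₃ K d α) ⊗ (hat (K * d) g α ⊗ hat (K * d) h α) ⊗ (-½ ^ω hash α))
    ≡ (⅓ ^ω K ⊗ ⅑ ^ω (K * d)) ⊗ sumOver³ (allVecs K) (allVecs (K * d)) (allVecs (K * d))
        (λ x y z → Σ∈ (K * d) λ α → fourierWeight K d x y z α ⊗ (f x ⊗ g y ⊗ h z))
fourier-expansion K d f g h = begin
  Σ∈ L (λ α → hat K f (π₃ K d α) ⊗ (hat L g α ⊗ hat L h α) ⊗ (-½ ^ω hash α))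
    ≡⟨ sumOver-cong Ys term ⟩
  Σ∈ L (λ α → scale ⊗ sumOver³ Xs Ys Ys (λ x y z → fourierWeight K d x y z α ⊗ (f x ⊗ g y ⊗ h z)))
    ≡⟨ sym (⊗-distribˡ-sumOver scale Ys _) ⟩
  scale ⊗ Σ∈ L (λ α → sumOver³ Xs Ys Ys (λ x y z → fourierWeight K d x y z α ⊗ (f x ⊗ g y ⊗ h z)))
    ≡⟨ cong (scale ⊗_) (sumOver-comm³ Ys Xs Ys Ys _) ⟩
  scale ⊗ sumOver³ Xs Ys Ys (λ x y z → Σ∈ L λ α → fourierWeight K d x y z α ⊗ (f x ⊗ g y ⊗ h z)) ∎
  where
  L = K * d
  Xs = allVecs K
  Ys = allVecs L
  scale = ⅓ ^ω K ⊗ ⅑ ^ω L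
  regroup : ∀ p q X Y Z c → ((p ⊗ X) ⊗ ((q ⊗ Y) ⊗ (q ⊗ Z))) ⊗ c ≡ (p ⊗ (q ⊗ q)) ⊗ (c ⊗ (X ⊗ (Y ⊗ Z)))
  regroup = solve-∀ Qω-ring
  separate : ∀ c f g h χ₁ χ₂ χ₃ →
    c ⊗ ((f ⊗ χ₁) ⊗ ((g ⊗ χ₂) ⊗ (h ⊗ χ₃))) ≡ (c ⊗ (χ₁ ⊗ (χ₂ ⊗ χ₃))) ⊗ (f ⊗ g ⊗ h)
  separate = solve-∀ Qω-ring
  term : ∀ α → hat K f (π₃ K d α) ⊗ (hat L g α ⊗ hat L h α) ⊗ (-½ ^ω hash α)
               ≡ scale ⊗ sumOver³ Xs Ys Ys (λ x y z → fourierWeight K d x y z α ⊗ (f x ⊗ g y ⊗ h z))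
  term α = begin
    (⅓ ^ω K ⊗ X) ⊗ ((⅓ ^ω L ⊗ Y) ⊗ (⅓ ^ω L ⊗ Z)) ⊗ c
      ≡⟨ regroup (⅓ ^ω K) (⅓ ^ω L) X Y Z c ⟩
    (⅓ ^ω K ⊗ (⅓ ^ω L ⊗ ⅓ ^ω L)) ⊗ (c ⊗ (X ⊗ (Y ⊗ Z)))
      ≡⟨ cong₂ (λ p q → (⅓ ^ω K ⊗ p) ⊗ (c ⊗ q)) (sym (^ω-distrib-⊗ ⅓ ⅓ L)) (sumOver-⊗³ Xs Ys Ys fχ gχ hχ) ⟩
    scale ⊗ (c ⊗ sumOver³ Xs Ys Ys (λ x y z → fχ x ⊗ (gχ y ⊗ hχ z)))
      ≡⟨ cong (scale ⊗_) (⊗-distribˡ-sumOver³ c Xs Ys Ys _) ⟩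
    scale ⊗ sumOver³ Xs Ys Ys (λ x y z → c ⊗ (fχ x ⊗ (gχ y ⊗ hχ z)))
      ≡⟨ cong (scale ⊗_) (sumOver³-cong Xs Ys Ys λ x y z →
           separate c (f x) (g y) (h z) (χ (dot (π₃ K d α) x)) (χ (dot α y)) (χ (dot α z))) ⟩
    scale ⊗ sumOver³ Xs Ys Ys (λ x y z → fourierWeight K d x y z α ⊗ (f x ⊗ g y ⊗ h z)) ∎
    where
    c = -½ ^ω hash α
    fχ : Vec Z3 K → Qω
    fχ x = f x ⊗ χ (dot (π₃ K d α) x)
    gχ hχ : Vec Z3 L → Qω
    gχ y = g y ⊗ χ (dot α y)
    hχ z = h z ⊗ χ (dot α z)
    X = Σ∈ K fχ
    Y = Σ∈ L gχ
    Z = Σ∈ L hχ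

𝔼4NAT-fourier : ∀ K d (f : Vec Z3 K → Qω) (g h : Vec Z3 (K * d) → Qω) →
  𝔼4NAT K d (λ x y z _ → f x ⊗ g y ⊗ h z)
    ≡ Σ∈ (K * d) (λ α → hat K f (π₃ K d α) ⊗ (hat (K * d) g α ⊗ hat (K * d) h α) ⊗ (-½ ^ω hash α))
𝔼4NAT-fourier K d f g h =
  trans (𝔼4NAT-expansion K d (λ x y z → f x ⊗ g y ⊗ h z)) (sym (fourier-expansion K d f g h))

lemma3p6 : (K d : ℕ) → 1 ≤ K → 1 ≤ d →
    (f : Vec Z3 K → Qω) → (g : Vec Z3 (K * d) → Qω) →
    Folded K f → Folded (K * d) g →
    𝔼4NAT K d (λ x y z w → f x ⊗ g y ⊗ g z)
      ≡ Σ∈ (K * d) (λ α → hat K f (π₃ K d α) ⊗ (hat (K * d) g α ^ω 2)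
                            ⊗ (embed (-[1+ 0 ] / 2) ^ω hash α))
lemma3p6 K d _ _ f g _ _ = trans (𝔼4NAT-fourier K d f g g)
  (sumOver-cong (allVecs (K * d)) λ α →
    cong (λ p → hat K f (π₃ K d α) ⊗ (hat (K * d) g α ⊗ p) ⊗ (-½ ^ω hash α))
         (sym (⊗-identityʳ (hat (K * d) g α))))
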